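{- Let $b\ge2$, $h\ge1$, and let $\mathbb T_b^{h+1}$ be the $b$-ary tree truncated at level $h+1$, with an arbitrary initial rotor configuration, and with sink set $S$ equal to the set of its $b^h$ vertices at level $h+1$. If $1+b+\cdots+b^h$ particles are started in succession at $\rho$ and each is stopped when it enters $S\cup\{\rho\}$, then exactly one particle is absorbed at each vertex of $S$, and all remaining particles are absorbed at $\rho$.
   Context: The $b$-ary tree $\mathbb T_b$ is the rooted tree whose root $\rho$ has exactly one child and in which every non-root vertex has exactly $b$ children; the level of a vertex is its graph distance from $\rho$. $\mathbb T_b^{h+1}$ is the subtree induced by the vertices of level at most $h+1$. For a vertex $v$ at level between $1$ and $h$, $v^{(0)}$ is its parent and $v^{(1)},\dots,v^{(b)}$ its children, with cyclic order of neighbours $v^{(0)},\dots,v^{(b)}$; a rotor configuration assigns to each such $v$ a value $r(v)\in\{0,\dots,b\}$, meaning the rotor at $v$ points to $v^{(r(v))}$; the rotor at $\rho$ always points to its only child. Rotor walk: at each step the rotor at the particle's current vertex is advanced to the next neighbour in the cyclic order, and the particle moves there. Each particle starts at $\rho$, moves to its child, and continues by rotor walk until its first entry to $S\cup\{\rho\}$; the next particle starts with the rotors left by the previous ones. -}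

module Defs where

open import Data.Nat using (ℕ; zero; suc; _+_; _^_; _<_)
open import Data.Nat.DivMod using (_%_; m%n<n)
open import Data.Fin using (Fin; zero; suc; toℕ; fromℕ<) renaming (_≟_ to _≟F_)
open import Data.List using (List; []; _∷_; length; map; upTo; filter)
open import Data.Nat.ListAction using (sum)
open import Data.List.Properties using (≡-dec)
open import Data.Product using (Σ; _×_; _,_)
open import Relation.Binary.PropositionalEquality using (_≡_; refl; cong)
open import Relation.Nullary using (Dec; yes; no)
open import Data.Bool using (if_then_else_)
open import Relation.Nullary.Decidable using (⌊_⌋)

geomSum : ℕ → ℕ → ℕ
geomSum b h = sum (map (b ^_) (upTo (suc h)))

module Tree (b h : ℕ) where

  -- A non-root vertex is encoded by the (reversed) path of child indices
  -- from the unique level-1 vertex:  node []  is the child of ρ,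
  -- node (i ∷ p) is the (i+1)-th child of node p.  Level of node p is 1 + length p.
  data Vertex : Set where
    root : Vertex
    node : List (Fin b) → Vertex

  -- rotor value k ∈ {0..b}: 0 = parent, (suc i) = child i (the (i+1)-th child).
  -- Only values at internal vertices (length p < h, i.e. levels 1..h) are ever used.
  Config : Set
  Config = List (Fin b) → Fin (suc b)

  next : Fin (suc b) → Fin (suc b)
  next k = fromℕ< (m%n<n (suc (toℕ k)) (suc b))

  nbr : List (Fin b) → Fin (suc b) → Vertex
  nbr []      zero    = root
  nbr (i ∷ p) zero    = node p
  nbr p       (suc i) = node (i ∷ p)

  update : Config → List (Fin b) → Fin (suc b) → Config
  update r p k q = if ⌊ ≡-dec _≟F_ q p ⌋ then k else r q

  -- Walk r x r' v : a particle currently at x, with rotor configuration r,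
  -- performs rotor walk until its first entry into S ∪ {ρ} (S = level h+1),
  -- where it is absorbed at v, leaving rotor configuration r'.
  data Walk (r : Config) : Vertex → Config → Vertex → Set where
    atRoot : Walk r root r root
    atSink : ∀ {p} → length p ≡ h → Walk r (node p) r (node p)
    step   : ∀ {p r' v} → length p < h →
             Walk (update r p (next (r p))) (nbr p (next (r p))) r' v →
             Walk r (node p) r' v

  -- A particle started at ρ first moves to ρ's only child, then rotor-walks.
  Particle : Config → Config → Vertex → Set
  Particle r r' v = Walk r (node []) r' v

  data Run : ℕ → Config → List Vertex → Set where
    done : ∀ {r} → Run zero r []
    more : ∀ {n r r' v vs} → Particle r r' v → Run n r' vs → Run (suc n) r (v ∷ vs)

  _≟V_ : (u v : Vertex) → Dec (u ≡ v)
  root ≟V root = yes refl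
  root ≟V node _ = no λ ()
  node _ ≟V root = no λ ()
  node p ≟V node q with ≡-dec _≟F_ p q
  ... | yes refl = yes refl
  ... | no ne = no λ { refl → ne refl }

  count : Vertex → List Vertex → ℕ
  count v vs = length (filter (_≟V v) vs)

module Submission where

-- A subtree of height d is modelled by a RotorTree d recording the rotors of its internal
-- vertices; a particle entering it from above either escapes back up or is absorbed at one of
-- its b ^ d leaves. By induction on d, of 1 + b + ⋯ + b ^ d particles sent in one after
-- another each leaf absorbs exactly one and the other 1 + b + ⋯ + b ^ (d - 1) escape.
-- For the inductive step, follow the top rotor: during a full turn of b + 1 moves it points
-- once in every direction, so 1 + ⋯ + b ^ (d - 1) full turns send that many particles up and
-- as many into each child, to which the induction hypothesis applies. These turns therefore
-- emit (1 + ⋯ + b ^ (d - 1)) + b · b ^ d outcomes, so they are exactly the moves made by the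
-- first 1 + ⋯ + b ^ d particles.

open import Defs
open import Data.Fin using (Fin; zero; suc; toℕ; punchIn) renaming (_≟_ to _≟F_)
open import Data.Fin.Properties using (toℕ-injective; toℕ<n; toℕ-fromℕ<; punchInᵢ≢i)
open import Data.List as List using (List; []; _∷_; _∷ʳ′_; _++_; _∷ʳ_; length; map; filter)
open import Data.List.Properties
  using (filter-accept; filter-reject; filter-++; length-++; ≡-dec; upTo-∷ʳ; map-++;
         ∷ʳ-injectiveˡ; ∷ʳ-injectiveʳ; ++-assoc; ++-cancelʳ; ++-identityʳ)
open import Data.List.Relation.Binary.Permutation.Propositional
  using (_↭_; ↭-refl; ↭-trans; module PermutationReasoning)
open import Data.List.Relation.Binary.Permutation.Propositional.Properties using (↭-length; filter-↭; ∷↭∷ʳ)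
open import Data.List.Relation.Unary.All as All using (All; []; _∷_)
open import Data.List.Relation.Unary.All.Properties using (++⁺; map⁺)
open import Data.Nat using (ℕ; zero; suc; _+_; _*_; _≤_; _<_; _^_; z≤n; s≤s)
open import Data.Nat.DivMod using (_%_; m%n<n; m<n⇒m%n≡m; n%n≡0)
open import Data.Nat.GeneralisedArithmetic using (iterate)
open import Data.Nat.Induction using (<-rec)
import Data.Nat.ListAction as ListAction
open import Data.Nat.ListAction.Properties using (sum-++)
open import Data.Nat.Properties
open import Algebra.Properties.CommutativeMonoid.Sum +-0-commutativeMonoid
  using (sum; sum-syntax; sum-remove; sum-cong-≗)
open import Data.Nat.Tactic.RingSolver using (solve-∀)
open import Data.Product as Product using (Σ; _×_; _,_; proj₁; proj₂)
open import Data.Sum using (_⊎_; inj₁; inj₂)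
open import Data.Unit using (⊤; tt)
open import Data.Vec using (Vec; lookup; tabulate; _[_]≔_)
open import Data.Vec.Functional using (removeAt)
open import Data.Vec.Properties using (lookup∘update; lookup∘update′; lookup∘tabulate)
open import Function using (_∘_)
open import Relation.Binary.Definitions using (DecidableEquality)
open import Relation.Binary.PropositionalEquality
open import Relation.Nullary using (¬_; Dec; yes; no; contradiction)
import Relation.Nullary.Decidable as Dec

occurrences : {A : Set} → DecidableEquality A → A → List A → ℕ
occurrences _≟_ x xs = length (filter (_≟ x) xs)

module _ {A : Set} (_≟_ : DecidableEquality A) where

  occurrences-accept : ∀ {x} y xs → y ≡ x → occurrences _≟_ x (y ∷ xs) ≡ suc (occurrences _≟_ x xs)
  occurrences-accept _ _ y≡x = cong length (filter-accept (_≟ _) y≡x)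

  occurrences-reject : ∀ {x} y xs → y ≢ x → occurrences _≟_ x (y ∷ xs) ≡ occurrences _≟_ x xs
  occurrences-reject _ _ y≢x = cong length (filter-reject (_≟ _) y≢x)

  occurrences-++ : ∀ x xs ys → occurrences _≟_ x (xs ++ ys) ≡ occurrences _≟_ x xs + occurrences _≟_ x ys
  occurrences-++ x xs ys = trans (cong length (filter-++ (_≟ x) xs ys)) (length-++ (filter (_≟ x) xs))

  occurrences-↭ : ∀ x {xs ys} → xs ↭ ys → occurrences _≟_ x xs ≡ occurrences _≟_ x ys
  occurrences-↭ x p = ↭-length (filter-↭ (_≟ x) p)

module _ {A B : Set} (_≟A_ : DecidableEquality A) (_≟B_ : DecidableEquality B)
         (f : A → B) (f-injective : ∀ {x y} → f x ≡ f y → x ≡ y) where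

  occurrences-map-injective : ∀ x xs → occurrences _≟B_ (f x) (map f xs) ≡ occurrences _≟A_ x xs
  occurrences-map-injective x [] = refl
  occurrences-map-injective x (y ∷ xs) = by-cases (y ≟A x)
    where
    by-cases : Dec (y ≡ x) → occurrences _≟B_ (f x) (map f (y ∷ xs)) ≡ occurrences _≟A_ x (y ∷ xs)
    by-cases (yes y≡x) = trans (occurrences-accept _≟B_ (f y) (map f xs) (cong f y≡x))
                           (trans (cong suc (occurrences-map-injective x xs)) (sym (occurrences-accept _≟A_ y xs y≡x)))
    by-cases (no y≢x)  = trans (occurrences-reject _≟B_ (f y) (map f xs) (y≢x ∘ f-injective))
                           (trans (occurrences-map-injective x xs) (sym (occurrences-reject _≟A_ y xs y≢x)))

module _ {A : Set} (f : A → A) where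

  iterate-commute : ∀ x n → iterate f (f x) n ≡ f (iterate f x n)
  iterate-commute x zero    = refl
  iterate-commute x (suc n) = iterate-commute (f x) n

  iterate-+ : ∀ x m n → iterate f x (m + n) ≡ iterate f (iterate f x m) n
  iterate-+ x zero    n = refl
  iterate-+ x (suc m) n = iterate-+ (f x) m n

  List-iterate-map : ∀ x n → List.iterate f (f x) n ≡ map f (List.iterate f x n)
  List-iterate-map x zero    = refl
  List-iterate-map x (suc n) = cong (f x ∷_) (List-iterate-map (f x) n)

  List-iterate-snoc : ∀ x n → List.iterate f x (suc n) ≡ List.iterate f x n ∷ʳ iterate f x n
  List-iterate-snoc x zero    = refl
  List-iterate-snoc x (suc n) = cong (x ∷_) (List-iterate-snoc (f x) n)

  List-iterate-+ : ∀ x m n → List.iterate f x (m + n) ≡ List.iterate f x m ++ List.iterate f (iterate f x m) n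
  List-iterate-+ x zero    n = refl
  List-iterate-+ x (suc m) n = cong (x ∷_) (List-iterate-+ (f x) m n)

module Orbit (b h : ℕ) where
  open Tree b h

  orbit : Fin (suc b) → ℕ → List (Fin (suc b))
  orbit k = List.iterate next (next k)

  toℕ-next : ∀ k → toℕ (next k) ≡ suc (toℕ k) % suc b
  toℕ-next k = toℕ-fromℕ< (m%n<n (suc (toℕ k)) (suc b))

  toℕ-iterate-zero : ∀ n → n < suc b → toℕ (iterate next zero n) ≡ n
  toℕ-iterate-zero zero    _   = refl
  toℕ-iterate-zero (suc n) n<m = begin
    toℕ (iterate next (next zero) n)         ≡⟨ cong toℕ (iterate-commute next zero n) ⟩
    toℕ (next (iterate next zero n))         ≡⟨ toℕ-next (iterate next zero n) ⟩
    suc (toℕ (iterate next zero n)) % suc b  ≡⟨ cong (λ t → suc t % suc b) (toℕ-iterate-zero n (<⇒≤ n<m)) ⟩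
    suc n % suc b                            ≡⟨ m<n⇒m%n≡m n<m ⟩
    suc n                                    ∎
    where open ≡-Reasoning

  iterate-toℕ : ∀ k → iterate next zero (toℕ k) ≡ k
  iterate-toℕ k = toℕ-injective (toℕ-iterate-zero (toℕ k) (toℕ<n k))

  iterate-period : ∀ k → iterate next k (suc b) ≡ k
  iterate-period k = begin
    iterate next k (suc b)                             ≡⟨ cong (λ x → iterate next x (suc b)) (iterate-toℕ k) ⟨
    iterate next (iterate next zero (toℕ k)) (suc b)   ≡⟨ iterate-+ next zero (toℕ k) (suc b) ⟨
    iterate next zero (toℕ k + suc b)                  ≡⟨ cong (iterate next zero) (+-comm (toℕ k) (suc b)) ⟩
    iterate next zero (suc b + toℕ k)                  ≡⟨ iterate-+ next zero (suc b) (toℕ k) ⟩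
    iterate next (iterate next zero (suc b)) (toℕ k)   ≡⟨ cong (λ x → iterate next x (toℕ k)) period-zero ⟩
    iterate next zero (toℕ k)                          ≡⟨ iterate-toℕ k ⟩
    k                                                  ∎
    where
    open ≡-Reasoning
    period-zero : iterate next zero (suc b) ≡ zero
    period-zero = toℕ-injective (begin
      toℕ (iterate next (next zero) b)   ≡⟨ cong toℕ (iterate-commute next zero b) ⟩
      toℕ (next (iterate next zero b))   ≡⟨ toℕ-next (iterate next zero b) ⟩
      suc (toℕ (iterate next zero b)) % suc b  ≡⟨ cong (λ t → suc t % suc b) (toℕ-iterate-zero b ≤-refl) ⟩
      suc b % suc b                      ≡⟨ n%n≡0 (suc b) ⟩
      0                                  ∎)

  next-injective : ∀ {x y} → next x ≡ next y → x ≡ y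
  next-injective {x} {y} eq = begin
    x                        ≡⟨ iterate-period x ⟨
    iterate next (next x) b  ≡⟨ cong (λ z → iterate next z b) eq ⟩
    iterate next (next y) b  ≡⟨ iterate-period y ⟩
    y                        ∎
    where open ≡-Reasoning

  orbit-rotate : ∀ k → orbit (next k) (suc b) ↭ orbit k (suc b)
  orbit-rotate k = begin
    orbit (next k) (suc b)                             ≡⟨ List-iterate-snoc next (next (next k)) b ⟩
    orbit (next k) b ∷ʳ iterate next (next k) (suc b)  ≡⟨ cong (orbit (next k) b ∷ʳ_) (iterate-period (next k)) ⟩
    orbit (next k) b ∷ʳ next k                         ↭⟨ ∷↭∷ʳ (next k) (orbit (next k) b) ⟨
    next k ∷ orbit (next k) b                          ∎
    where open PermutationReasoning

  orbit-iterate-rotate : ∀ k t → orbit (iterate next k t) (suc b) ↭ orbit k (suc b)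
  orbit-iterate-rotate k zero    = ↭-refl
  orbit-iterate-rotate k (suc t) = ↭-trans (orbit-iterate-rotate (next k) t) (orbit-rotate k)

  occurrences-orbit-shift : ∀ x y a n →
    occurrences _≟F_ (iterate next x a) (orbit (iterate next y a) n) ≡ occurrences _≟F_ x (orbit y n)
  occurrences-orbit-shift x y zero    n = refl
  occurrences-orbit-shift x y (suc a) n = begin
    occurrences _≟F_ (iterate next (next x) a) (orbit (iterate next (next y) a) n)
      ≡⟨ occurrences-orbit-shift (next x) (next y) a n ⟩
    occurrences _≟F_ (next x) (orbit (next y) n)
      ≡⟨ cong (occurrences _≟F_ (next x)) (List-iterate-map next (next y) n) ⟩
    occurrences _≟F_ (next x) (map next (orbit y n))
      ≡⟨ occurrences-map-injective _≟F_ _≟F_ next next-injective x (orbit y n) ⟩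
    occurrences _≟F_ x (orbit y n) ∎
    where open ≡-Reasoning

  orbit-zero-avoids-zero : ∀ n → n ≤ b → occurrences _≟F_ zero (orbit zero n) ≡ 0
  orbit-zero-avoids-zero zero    _   = refl
  orbit-zero-avoids-zero (suc n) n<m = begin
    occurrences _≟F_ zero (orbit zero (suc n))
      ≡⟨ cong (occurrences _≟F_ zero) (List-iterate-snoc next (next zero) n) ⟩
    occurrences _≟F_ zero (orbit zero n ∷ʳ iterate next zero (suc n))
      ≡⟨ occurrences-++ _≟F_ zero (orbit zero n) _ ⟩
    occurrences _≟F_ zero (orbit zero n) + occurrences _≟F_ zero (iterate next zero (suc n) ∷ [])
      ≡⟨ cong₂ _+_ (orbit-zero-avoids-zero n (<⇒≤ n<m)) (occurrences-reject _≟F_ _ [] last≢zero) ⟩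
    0 ∎
    where
    open ≡-Reasoning
    last≢zero : iterate next zero (suc n) ≢ zero
    last≢zero eq with trans (sym (toℕ-iterate-zero (suc n) (s≤s n<m))) (cong toℕ eq)
    ... | ()

  orbit-rotate-to-zero : ∀ k → orbit k (suc b) ↭ orbit zero (suc b)
  orbit-rotate-to-zero k =
    subst (λ x → orbit x (suc b) ↭ orbit zero (suc b)) (iterate-toℕ k) (orbit-iterate-rotate zero (toℕ k))

  occurrences-zero-orbit-zero : occurrences _≟F_ zero (orbit zero (suc b)) ≡ 1
  occurrences-zero-orbit-zero = begin
    occurrences _≟F_ zero (orbit zero (suc b))
      ≡⟨ cong (occurrences _≟F_ zero) (List-iterate-snoc next (next zero) b) ⟩
    occurrences _≟F_ zero (orbit zero b ∷ʳ iterate next zero (suc b))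
      ≡⟨ occurrences-++ _≟F_ zero (orbit zero b) _ ⟩
    occurrences _≟F_ zero (orbit zero b) + occurrences _≟F_ zero (iterate next zero (suc b) ∷ [])
      ≡⟨ cong₂ _+_ (orbit-zero-avoids-zero b ≤-refl) (occurrences-accept _≟F_ _ [] (iterate-period zero)) ⟩
    1 ∎
    where open ≡-Reasoning

  occurrences-orbit-turn : ∀ j k → occurrences _≟F_ j (orbit k (suc b)) ≡ 1
  occurrences-orbit-turn j k = begin
    occurrences _≟F_ j (orbit k (suc b))
      ≡⟨ occurrences-↭ _≟F_ j (orbit-rotate-to-zero k) ⟩
    occurrences _≟F_ j (orbit zero (suc b))
      ≡⟨ occurrences-↭ _≟F_ j (orbit-rotate-to-zero j) ⟨
    occurrences _≟F_ j (orbit j (suc b))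
      ≡⟨ cong (λ x → occurrences _≟F_ x (orbit x (suc b))) (iterate-toℕ j) ⟨
    occurrences _≟F_ (iterate next zero (toℕ j)) (orbit (iterate next zero (toℕ j)) (suc b))
      ≡⟨ occurrences-orbit-shift zero zero (toℕ j) (suc b) ⟩
    occurrences _≟F_ zero (orbit zero (suc b))
      ≡⟨ occurrences-zero-orbit-zero ⟩
    1 ∎
    where open ≡-Reasoning

  orbit-+ : ∀ k m n → orbit k (m + n) ≡ orbit k m ++ orbit (iterate next k m) n
  orbit-+ k m n = trans (List-iterate-+ next (next k) m n)
                        (cong (λ x → orbit k m ++ List.iterate next x n) (iterate-commute next k m))

  occurrences-orbit-turns : ∀ j k n → occurrences _≟F_ j (orbit k (n * suc b)) ≡ n
  occurrences-orbit-turns j k zero    = refl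
  occurrences-orbit-turns j k (suc n) = begin
    occurrences _≟F_ j (orbit k (suc b + n * suc b))
      ≡⟨ cong (occurrences _≟F_ j) (orbit-+ k (suc b) (n * suc b)) ⟩
    occurrences _≟F_ j (orbit k (suc b) ++ orbit (iterate next k (suc b)) (n * suc b))
      ≡⟨ occurrences-++ _≟F_ j (orbit k (suc b)) _ ⟩
    occurrences _≟F_ j (orbit k (suc b)) + occurrences _≟F_ j (orbit (iterate next k (suc b)) (n * suc b))
      ≡⟨ cong₂ _+_ (occurrences-orbit-turn j k)
               (trans (cong (λ x → occurrences _≟F_ j (orbit x (n * suc b))) (iterate-period k))
                      (occurrences-orbit-turns j k n)) ⟩
    suc n ∎
    where open ≡-Reasoning

sum-const : ∀ n c → ∑[ i < n ] c ≡ n * c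
sum-const zero    c = refl
sum-const (suc n) c = cong (c +_) (sum-const n c)

sum-incrementAt : ∀ {n} (f g : Fin n → ℕ) j → g j ≡ suc (f j) → (∀ i → j ≢ i → g i ≡ f i) →
  sum g ≡ suc (sum f)
sum-incrementAt {suc n} f g j gj≡1+fj g≗f = begin
  sum g                             ≡⟨ sum-remove g ⟩
  g j + sum (removeAt g j)          ≡⟨ cong₂ _+_ gj≡1+fj (sum-cong-≗ λ k → g≗f _ (punchInᵢ≢i j k ∘ sym)) ⟩
  suc (f j + sum (removeAt f j))    ≡⟨ cong suc (sum-remove f) ⟨
  suc (sum f)                       ∎
  where open ≡-Reasoning

length-∷ʳ : ∀ {A : Set} (xs : List A) x → length (xs ∷ʳ x) ≡ suc (length xs)
length-∷ʳ xs x = trans (length-++ xs) (+-comm (length xs) 1)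

turns-split : ∀ r p b → (r + p) * suc b ≡ (r + p + b * p) + b * r
turns-split = solve-∀

geomSum-suc : ∀ b d → geomSum b (suc d) ≡ geomSum b d + b ^ suc d
geomSum-suc b d = begin
  ListAction.sum (powers (List.upTo (suc (suc d))))      ≡⟨ cong (ListAction.sum ∘ powers) (upTo-∷ʳ (suc d)) ⟨
  ListAction.sum (powers (List.upTo (suc d) ∷ʳ suc d))   ≡⟨ cong ListAction.sum (map-++ (b ^_) (List.upTo (suc d)) _) ⟩
  ListAction.sum (powers (List.upTo (suc d)) ++ b ^ suc d ∷ [])  ≡⟨ sum-++ (powers (List.upTo (suc d))) _ ⟩
  geomSum b d + (b ^ suc d + 0)                          ≡⟨ cong (geomSum b d +_) (+-identityʳ (b ^ suc d)) ⟩
  geomSum b d + b ^ suc d                                ∎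
  where
  open ≡-Reasoning
  powers = map (b ^_)

run : {S O : Set} → (S → O × S) → ℕ → S → List O × S
run step zero    s = [] , s
run step (suc n) s = Product.map₁ (proj₁ (step s) ∷_) (run step n (proj₂ (step s)))

length-run : ∀ {S O : Set} (step : S → O × S) n s → length (proj₁ (run step n s)) ≡ n
length-run step zero    s = refl
length-run step (suc n) s = cong suc (length-run step n (proj₂ (step s)))

module Model (b h : ℕ) where
  open Tree b h
  open Orbit b h

  _≟L_ : DecidableEquality (List (Fin b))
  _≟L_ = ≡-dec _≟F_

  data RotorTree : ℕ → Set where
    leaf : RotorTree 0
    fork : ∀ {d} → Fin (suc b) → Vec (RotorTree d) b → RotorTree (suc d)

  rotor : ∀ {d} → RotorTree (suc d) → Fin (suc b)
  rotor (fork k _) = k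

  childAt : ∀ {d} → Fin b → RotorTree (suc d) → RotorTree d
  childAt i (fork _ cs) = lookup cs i

  -- absorbed s: absorbed at the leaf whose path below the top of the subtree, reversed as in
  -- Tree, is s; for a subtree hanging at node p that leaf is node (s ++ p).
  data Outcome : Set where
    escaped  : Outcome
    absorbed : List (Fin b) → Outcome

  absorbed-injective : ∀ {s s′} → absorbed s ≡ absorbed s′ → s ≡ s′
  absorbed-injective refl = refl

  _≟O_ : DecidableEquality Outcome
  escaped    ≟O escaped     = yes refl
  escaped    ≟O absorbed _  = no λ ()
  absorbed _ ≟O escaped     = no λ ()
  absorbed s ≟O absorbed s′ = Dec.map′ (cong absorbed) absorbed-injective (s ≟L s′)

  data Event : Set where
    toParent : Event
    toChild  : Fin b → Outcome → Event

  mutual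
    enter : ∀ d → RotorTree d → Outcome × RotorTree d
    enter zero    leaf = absorbed [] , leaf
    enter (suc d) t    = enterWithin d (suc b) t

    -- The fuel b + 1 always suffices (within a full turn the rotor points to the parent),
    -- so the value returned on zero fuel is never used.
    enterWithin : ∀ d → ℕ → RotorTree (suc d) → Outcome × RotorTree (suc d)
    enterWithin d zero    t = escaped , t
    enterWithin d (suc f) t = proceed d f (visit d t)

    visit : ∀ d → RotorTree (suc d) → Event × RotorTree (suc d)
    visit d (fork k cs) = move d (next k) cs

    move : ∀ d → Fin (suc b) → Vec (RotorTree d) b → Event × RotorTree (suc d)
    move d zero    cs = toParent , fork zero cs
    move d (suc i) cs = toChild i (proj₁ (enter d (lookup cs i))) ,
                        fork (suc i) (cs [ i ]≔ proj₂ (enter d (lookup cs i)))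

    proceed : ∀ d → ℕ → Event × RotorTree (suc d) → Outcome × RotorTree (suc d)
    proceed d f (toParent , t)                = escaped , t
    proceed d f (toChild i escaped , t)       = enterWithin d f t
    proceed d f (toChild i (absorbed s) , t)  = absorbed (s ∷ʳ i) , t

  entries : ∀ d → ℕ → RotorTree d → List Outcome
  entries d n t = proj₁ (run (enter d) n t)

  events : ∀ d → ℕ → RotorTree (suc d) → List Event
  events d n t = proj₁ (run (visit d) n t)

  emit : Event → List Outcome
  emit toParent                 = escaped ∷ []
  emit (toChild i escaped)      = []
  emit (toChild i (absorbed s)) = absorbed (s ∷ʳ i) ∷ []

  emitted : List Event → List Outcome
  emitted = List.concatMap emit

  direction : Event → Fin (suc b)
  direction toParent      = zero
  direction (toChild i _) = suc i

  childOutcomes : Fin b → List Event → List Outcome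
  childOutcomes i []                 = []
  childOutcomes i (toParent ∷ es)    = childOutcomes i es
  childOutcomes i (toChild j o ∷ es) with j ≟F i
  ... | yes _ = o ∷ childOutcomes i es
  ... | no _  = childOutcomes i es

  childOutcomes-here : ∀ i o es → childOutcomes i (toChild i o ∷ es) ≡ o ∷ childOutcomes i es
  childOutcomes-here i o es with i ≟F i
  ... | yes _  = refl
  ... | no i≢i = contradiction refl i≢i

  childOutcomes-there : ∀ {i j} o es → j ≢ i → childOutcomes i (toChild j o ∷ es) ≡ childOutcomes i es
  childOutcomes-there {i} {j} o es j≢i with j ≟F i
  ... | yes j≡i = contradiction j≡i j≢i
  ... | no _    = refl

  move-direction : ∀ d x cs → direction (proj₁ (move d x cs)) ≡ x
  move-direction d zero    cs = refl
  move-direction d (suc i) cs = refl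

  move-rotor : ∀ d x cs → rotor (proj₂ (move d x cs)) ≡ x
  move-rotor d zero    cs = refl
  move-rotor d (suc i) cs = refl

  visits-directions : ∀ d n (t : RotorTree (suc d)) → map direction (events d n t) ≡ orbit (rotor t) n
  visits-directions d zero    t           = refl
  visits-directions d (suc n) (fork k cs) =
    cong₂ _∷_ (move-direction d (next k) cs)
              (trans (visits-directions d n _) (cong (λ x → orbit x n) (move-rotor d (next k) cs)))

  mutual
    visits-child : ∀ d n (t : RotorTree (suc d)) i →
      Product.map (childOutcomes i) (childAt i) (run (visit d) n t)
        ≡ run (enter d) (occurrences _≟F_ (suc i) (orbit (rotor t) n)) (childAt i t)
    visits-child d zero    t           i = refl
    visits-child d (suc n) (fork k cs) i = move-visits-child d n (next k) cs i

    move-visits-child : ∀ d n x cs i →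
      Product.map (childOutcomes i) (childAt i)
        (Product.map₁ (proj₁ (move d x cs) ∷_) (run (visit d) n (proj₂ (move d x cs))))
        ≡ run (enter d) (occurrences _≟F_ (suc i) (x ∷ orbit x n)) (lookup cs i)
    move-visits-child d n zero cs i = visits-child d n (fork zero cs) i
    -- Matching on j ≟F i also decides whether the head suc j of the orbit is counted.
    move-visits-child d n (suc j) cs i with j ≟F i
    ... | yes refl = begin
      Product.map₁ (o ∷_) (Product.map (childOutcomes i) (childAt i) (run (visit d) n t′))
        ≡⟨ cong (Product.map₁ (o ∷_)) (visits-child d n t′ i) ⟩
      Product.map₁ (o ∷_) (run (enter d) c (lookup (cs [ i ]≔ c′) i))
        ≡⟨ cong (λ u → Product.map₁ (o ∷_) (run (enter d) c u)) (lookup∘update i cs c′) ⟩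
      run (enter d) (suc c) (lookup cs i) ∎
      where
      open ≡-Reasoning
      o  = proj₁ (enter d (lookup cs i))
      c′ = proj₂ (enter d (lookup cs i))
      t′ = fork (suc i) (cs [ i ]≔ c′)
      c  = occurrences _≟F_ (suc i) (orbit (suc i) n)
    ... | no j≢i = begin
      Product.map (childOutcomes i) (childAt i) (run (visit d) n t′)
        ≡⟨ visits-child d n t′ i ⟩
      run (enter d) (occurrences _≟F_ (suc i) (orbit (suc j) n)) (lookup (cs [ j ]≔ c′) i)
        ≡⟨ cong (run (enter d) _) (lookup∘update′ (j≢i ∘ sym) cs c′) ⟩
      run (enter d) (occurrences _≟F_ (suc i) (orbit (suc j) n)) (lookup cs i) ∎
      where
      open ≡-Reasoning
      c′ = proj₂ (enter d (lookup cs j))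
      t′ = fork (suc j) (cs [ j ]≔ c′)

  emissions : ∀ d → ℕ → RotorTree (suc d) → List Outcome
  emissions d T t = emitted (events d T t)

  FirstEmission : ∀ d → ℕ → List Outcome → Outcome × RotorTree (suc d) → Set
  FirstEmission d T E (o , t′) = E ≡ [] ⊎ Σ ℕ λ T′ → T′ < T × E ≡ o ∷ emissions d T′ t′

  mutual
    enterWithin-first : ∀ d f (t : RotorTree (suc d)) T → 0 < occurrences _≟F_ zero (orbit (rotor t) f) →
      FirstEmission d T (emissions d T t) (enterWithin d f t)
    enterWithin-first d f       t           zero    _   = inj₁ refl
    enterWithin-first d (suc f) (fork k cs) (suc T) has-parent = move-first d f (next k) cs T has-parent

    move-first : ∀ d f x cs T → 0 < occurrences _≟F_ zero (x ∷ orbit x f) →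
      FirstEmission d (suc T) (emitted (proj₁ (move d x cs) ∷ events d T (proj₂ (move d x cs))))
                    (proceed d f (move d x cs))
    move-first d f zero    cs T _ = inj₂ (T , ≤-refl , refl)
    move-first d f (suc i) cs T has-parent with enter d (lookup cs i)
    ... | absorbed s , c′ = inj₂ (T , ≤-refl , refl)
    ... | escaped    , c′ with enterWithin-first d f (fork (suc i) (cs [ i ]≔ c′)) T has-parent
    ...   | inj₁ none               = inj₁ none
    ...   | inj₂ (T′ , T′<T , split) = inj₂ (T′ , m<n⇒m<1+n T′<T , split)

  parent-in-turn : ∀ k → 0 < occurrences _≟F_ zero (orbit k (suc b))
  parent-in-turn k = ≤-reflexive (sym (occurrences-orbit-turn zero k))

  -- Successive particles cut the stream of moves of the top rotor into consecutive blocks,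
  -- each emitting exactly the outcome of its particle.
  entries-emissions : ∀ d T (t : RotorTree (suc d)) →
    entries (suc d) (length (emissions d T t)) t ≡ emissions d T t
  entries-emissions d = <-rec _ λ T rec t →
    by-cases T t rec (enterWithin-first d (suc b) t T (parent-in-turn (rotor t)))
    where
    Matches : ℕ → Set
    Matches T = ∀ t → entries (suc d) (length (emissions d T t)) t ≡ emissions d T t

    by-cases : ∀ T t → (∀ {T′} → T′ < T → Matches T′) → FirstEmission d T (emissions d T t) (enter (suc d) t) →
      entries (suc d) (length (emissions d T t)) t ≡ emissions d T t
    by-cases T t rec (inj₁ none) rewrite none = refl
    by-cases T t rec (inj₂ (T′ , T′<T , split)) rewrite split =
      cong (proj₁ (enter (suc d) t) ∷_) (rec T′<T (proj₂ (enter (suc d) t)))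

  escapes : List Outcome → ℕ
  escapes = occurrences _≟O_ escaped

  data Exit (d : ℕ) : Outcome → Set where
    escaped  : Exit d escaped
    absorbed : ∀ {s} → length s ≡ d → Exit d (absorbed s)

  escapes-emitted : ∀ es → escapes (emitted es) ≡ occurrences _≟F_ zero (map direction es)
  escapes-emitted []                            = refl
  escapes-emitted (toParent ∷ es)               = cong suc (escapes-emitted es)
  escapes-emitted (toChild i escaped ∷ es)      = escapes-emitted es
  escapes-emitted (toChild i (absorbed s) ∷ es) = escapes-emitted es

  absorbed-emitted : ∀ s i es →
    occurrences _≟O_ (absorbed (s ∷ʳ i)) (emitted es) ≡ occurrences _≟O_ (absorbed s) (childOutcomes i es)
  absorbed-emitted s i []              = refl
  absorbed-emitted s i (toParent ∷ es) = absorbed-emitted s i es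
  absorbed-emitted s i (toChild j o ∷ es) with j ≟F i
  absorbed-emitted s i (toChild j escaped ∷ es)       | yes refl = absorbed-emitted s i es
  absorbed-emitted s i (toChild j escaped ∷ es)       | no _     = absorbed-emitted s i es
  absorbed-emitted s i (toChild j (absorbed s′) ∷ es) | yes refl with s′ ≟L s
  ... | yes refl = trans (occurrences-accept _≟O_ _ (emitted es) refl) (cong suc (absorbed-emitted s i es))
  ... | no s′≢s  = trans (occurrences-reject _≟O_ _ (emitted es) (s′≢s ∘ ∷ʳ-injectiveˡ s′ s ∘ absorbed-injective))
                         (absorbed-emitted s i es)
  absorbed-emitted s i (toChild j (absorbed s′) ∷ es) | no j≢i =
    trans (occurrences-reject _≟O_ _ (emitted es) (j≢i ∘ ∷ʳ-injectiveʳ s′ s ∘ absorbed-injective))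
          (absorbed-emitted s i es)

  All-childOutcomes-∷ : ∀ {P : Outcome → Set} i e es → All P (childOutcomes i (e ∷ es)) → All P (childOutcomes i es)
  All-childOutcomes-∷ i toParent      es ps = ps
  All-childOutcomes-∷ i (toChild j o) es ps with j ≟F i
  ... | yes _ = All.tail ps
  ... | no _  = ps

  All-childOutcomes-head : ∀ {P : Outcome → Set} i o es → All P (childOutcomes i (toChild i o ∷ es)) → P o
  All-childOutcomes-head i o es ps = All.head (subst (All _) (childOutcomes-here i o es) ps)

  emit-exits : ∀ d e es → (∀ i → All (Exit d) (childOutcomes i (e ∷ es))) → All (Exit (suc d)) (emit e)
  emit-exits d toParent                 _  _     = escaped ∷ []
  emit-exits d (toChild i escaped)      _  _     = []
  emit-exits d (toChild i (absorbed s)) es exits with All-childOutcomes-head i _ es (exits i)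
  ... | absorbed |s|≡d = absorbed (trans (length-∷ʳ s i) (cong suc |s|≡d)) ∷ []

  emitted-exits : ∀ d es → (∀ i → All (Exit d) (childOutcomes i es)) → All (Exit (suc d)) (emitted es)
  emitted-exits d []       _     = []
  emitted-exits d (e ∷ es) exits =
    ++⁺ (emit-exits d e es exits) (emitted-exits d es (λ i → All-childOutcomes-∷ i e es (exits i)))

  escapes-childOutcomes-absorbed : ∀ i j s es →
    escapes (childOutcomes i (toChild j (absorbed s) ∷ es)) ≡ escapes (childOutcomes i es)
  escapes-childOutcomes-absorbed i j s es with j ≟F i
  ... | yes _ = refl
  ... | no _  = refl

  length-emitted : ∀ es → length (emitted es) + ∑[ i < b ] escapes (childOutcomes i es) ≡ length es
  length-emitted [] = trans (sum-const b 0) (*-zeroʳ b)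
  length-emitted (toParent ∷ es) = cong suc (length-emitted es)
  length-emitted (toChild j escaped ∷ es) = begin
    length (emitted es) + sum (λ i → escapes (childOutcomes i (toChild j escaped ∷ es)))
      ≡⟨ cong (length (emitted es) +_) (sum-incrementAt _ _ j
              (cong escapes (childOutcomes-here j escaped es))
              (λ i j≢i → cong escapes (childOutcomes-there escaped es j≢i))) ⟩
    length (emitted es) + suc (sum (λ i → escapes (childOutcomes i es)))
      ≡⟨ +-suc (length (emitted es)) _ ⟩
    suc (length (emitted es) + sum (λ i → escapes (childOutcomes i es)))
      ≡⟨ cong suc (length-emitted es) ⟩
    suc (length es) ∎
    where open ≡-Reasoning
  length-emitted (toChild j (absorbed s) ∷ es) =
    cong suc (trans (cong (length (emitted es) +_) (sum-cong-≗ λ i → escapes-childOutcomes-absorbed i j s es))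
                    (length-emitted es))

  returns : ℕ → ℕ
  returns zero    = 0
  returns (suc d) = geomSum b d

  geomSum≡returns+leaves : ∀ d → geomSum b d ≡ returns d + b ^ d
  geomSum≡returns+leaves zero    = refl
  geomSum≡returns+leaves (suc d) = geomSum-suc b d

  record OnePerLeaf (d : ℕ) (os : List Outcome) : Set where
    field
      escapes-returns : escapes os ≡ returns d
      absorbed-once   : ∀ s → length s ≡ d → occurrences _≟O_ (absorbed s) os ≡ 1
      all-exits       : All (Exit d) os
  open OnePerLeaf

  emitted-onePerLeaf : ∀ d es → occurrences _≟F_ zero (map direction es) ≡ returns (suc d) →
    (∀ i → OnePerLeaf d (childOutcomes i es)) → OnePerLeaf (suc d) (emitted es)
  emitted-onePerLeaf d es parent children = record
    { escapes-returns = trans (escapes-emitted es) parent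
    ; absorbed-once   = once
    ; all-exits       = emitted-exits d es (all-exits ∘ children)
    }
    where
    once : ∀ s → length s ≡ suc d → occurrences _≟O_ (absorbed s) (emitted es) ≡ 1
    once s |s|≡1+d with List.initLast s
    ... | []       = contradiction |s|≡1+d λ ()
    ... | s′ ∷ʳ′ i = trans (absorbed-emitted s′ i es)
                           (absorbed-once (children i) s′ (suc-injective (trans (sym (length-∷ʳ s′ i)) |s|≡1+d)))

  length-after-turns : ∀ d L → L + b * returns d ≡ geomSum b d * suc b → L ≡ geomSum b (suc d)
  length-after-turns d L L+br≡T = trans (+-cancelʳ-≡ (b * r) L _ (begin
    L + b * r                    ≡⟨ L+br≡T ⟩
    geomSum b d * suc b          ≡⟨ cong (_* suc b) (geomSum≡returns+leaves d) ⟩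
    (r + p) * suc b              ≡⟨ turns-split r p b ⟩
    (r + p) + b * p + b * r      ≡⟨ cong (λ x → x + b * p + b * r) (geomSum≡returns+leaves d) ⟨
    geomSum b d + b * p + b * r  ∎)) (sym (geomSum-suc b d))
    where
    open ≡-Reasoning
    r = returns d
    p = b ^ d

  length-emitted-onePerLeaf : ∀ d es → (∀ i → OnePerLeaf d (childOutcomes i es)) →
    length (emitted es) + b * returns d ≡ length es
  length-emitted-onePerLeaf d es children = begin
    length (emitted es) + b * returns d
      ≡⟨ cong (length (emitted es) +_) (sum-const b (returns d)) ⟨
    length (emitted es) + ∑[ i < b ] returns d
      ≡⟨ cong (length (emitted es) +_) (sum-cong-≗ (sym ∘ escapes-returns ∘ children)) ⟩
    length (emitted es) + ∑[ i < b ] escapes (childOutcomes i es)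
      ≡⟨ length-emitted es ⟩
    length es ∎
    where open ≡-Reasoning

  entries-onePerLeaf : ∀ d (t : RotorTree d) → OnePerLeaf d (entries d (geomSum b d) t)
  entries-onePerLeaf zero leaf = record
    { escapes-returns = refl
    ; absorbed-once   = λ { [] _ → refl }
    ; all-exits       = absorbed refl ∷ []
    }
  entries-onePerLeaf (suc d) t@(fork k cs) =
    subst (OnePerLeaf (suc d)) (sym entries≡emitted) (emitted-onePerLeaf d es parent children)
    where
    T  = geomSum b d * suc b
    es = events d T t

    parent : occurrences _≟F_ zero (map direction es) ≡ geomSum b d
    parent = trans (cong (occurrences _≟F_ zero) (visits-directions d T t)) (occurrences-orbit-turns zero k (geomSum b d))

    children : ∀ i → OnePerLeaf d (childOutcomes i es)
    children i = subst (OnePerLeaf d) (sym (cong proj₁ (trans (visits-child d T t i)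
                   (cong (λ c → run (enter d) c (lookup cs i)) (occurrences-orbit-turns (suc i) k (geomSum b d))))))
                   (entries-onePerLeaf d (lookup cs i))

    entries≡emitted : entries (suc d) (geomSum b (suc d)) t ≡ emitted es
    entries≡emitted = subst (λ n → entries (suc d) n t ≡ emitted es)
      (length-after-turns d _ (trans (length-emitted-onePerLeaf d es children) (length-run (visit d) T t)))
      (entries-emissions d T t)

module Realisation (b h : ℕ) where
  open Tree b h
  open Orbit b h
  open Model b h

  Within : List (Fin b) → List (Fin b) → Set
  Within p q = Σ (List (Fin b)) λ s → q ≡ s ++ p

  UnchangedOutside : List (Fin b) → Config → Config → Set
  UnchangedOutside p r r′ = ∀ q → ¬ Within p q → r′ q ≡ r q

  UnchangedWithin : List (Fin b) → Config → Config → Set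
  UnchangedWithin p r r′ = ∀ s → r′ (s ++ p) ≡ r (s ++ p)

  Represents : ∀ {d} → List (Fin b) → RotorTree d → Config → Set
  Represents p leaf        r = ⊤
  Represents p (fork k cs) r = r p ≡ k × (∀ i → Represents (i ∷ p) (lookup cs i) r)

  length-below : ∀ s (i : Fin b) p → length p < length (s ++ i ∷ p)
  length-below s i p = subst (length p <_) (sym (length-++ s)) (m≤n+m (suc (length p)) (length s))

  not-within-child : ∀ i p → ¬ Within (i ∷ p) p
  not-within-child i p (s , p≡s++i∷p) = <-irrefl (cong length p≡s++i∷p) (length-below s i p)

  not-within-sibling : ∀ {i j} p → i ≢ j → ∀ s → ¬ Within (i ∷ p) (s ++ j ∷ p)
  not-within-sibling {i} {j} p i≢j s (s′ , eq) =
    i≢j (sym (∷ʳ-injectiveʳ s s′ (++-cancelʳ p (s ∷ʳ j) (s′ ∷ʳ i) (begin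
      (s ∷ʳ j) ++ p   ≡⟨ ++-assoc s (j ∷ []) p ⟩
      s ++ j ∷ p      ≡⟨ eq ⟩
      s′ ++ i ∷ p     ≡⟨ ++-assoc s′ (i ∷ []) p ⟨
      (s′ ∷ʳ i) ++ p  ∎))))
    where open ≡-Reasoning

  unchangedWithin-child : ∀ {p r r′} i → UnchangedWithin p r r′ → UnchangedWithin (i ∷ p) r r′
  unchangedWithin-child {p} {r} {r′} i same s =
    subst (λ q → r′ q ≡ r q) (++-assoc s (i ∷ []) p) (same (s ∷ʳ i))

  represents-unchanged : ∀ {d} p (t : RotorTree d) {r r′} →
    UnchangedWithin p r r′ → Represents p t r → Represents p t r′
  represents-unchanged p leaf        same _            = tt
  represents-unchanged p (fork k cs) {r} {r′} same (rp≡k , rep) = trans (same []) rp≡k , λ i →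
    represents-unchanged (i ∷ p) (lookup cs i) (unchangedWithin-child {p} {r} {r′} i same) (rep i)

  unchangedOutside-parent : ∀ {p r r′} i → UnchangedOutside (i ∷ p) r r′ → UnchangedOutside p r r′
  unchangedOutside-parent {p} i same q q∉p =
    same q λ { (s , q≡s++i∷p) → q∉p (s ∷ʳ i , trans q≡s++i∷p (sym (++-assoc s (i ∷ []) p))) }

  unchangedOutside-sibling : ∀ {p r r′ i j} → UnchangedOutside (i ∷ p) r r′ → i ≢ j → UnchangedWithin (j ∷ p) r r′
  unchangedOutside-sibling {p} same i≢j s = same (s ++ _ ∷ p) (not-within-sibling p i≢j s)

  unchangedOutside-trans : ∀ {p r₁ r₂ r₃} →
    UnchangedOutside p r₁ r₂ → UnchangedOutside p r₂ r₃ → UnchangedOutside p r₁ r₃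
  unchangedOutside-trans same₁₂ same₂₃ q q∉p = trans (same₂₃ q q∉p) (same₁₂ q q∉p)

  update-here : ∀ r p k → update r p k p ≡ k
  update-here r p k with p ≟L p
  ... | yes _  = refl
  ... | no p≢p = contradiction refl p≢p

  update-elsewhere : ∀ r p k q → q ≢ p → update r p k q ≡ r q
  update-elsewhere r p k q q≢p with q ≟L p
  ... | yes q≡p = contradiction q≡p q≢p
  ... | no _    = refl

  update-unchangedOutside : ∀ r p k → UnchangedOutside p r (update r p k)
  update-unchangedOutside r p k q q∉p = update-elsewhere r p k q λ q≡p → q∉p ([] , q≡p)

  update-unchangedWithin-child : ∀ r p k i → UnchangedWithin (i ∷ p) r (update r p k)
  update-unchangedWithin-child r p k i s =
    update-elsewhere r p k (s ++ i ∷ p) λ eq → <-irrefl (cong length (sym eq)) (length-below s i p)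

  represents-after-child : ∀ {d p x r₁ r₂ i} (cs : Vec (RotorTree d) b) c′ →
    r₁ p ≡ x → (∀ j → Represents (j ∷ p) (lookup cs j) r₁) →
    Represents (i ∷ p) c′ r₂ → UnchangedOutside (i ∷ p) r₁ r₂ →
    Represents p (fork x (cs [ i ]≔ c′)) r₂
  represents-after-child {p = p} {i = i} cs c′ r₁p≡x reps rep′ same =
    trans (same p (not-within-child i p)) r₁p≡x , child
    where
    child : ∀ j → Represents (j ∷ p) (lookup (cs [ i ]≔ c′) j) _
    child j with i ≟F j
    ... | yes refl = subst (λ c → Represents (i ∷ p) c _) (sym (lookup∘update i cs c′)) rep′
    ... | no i≢j   = subst (λ c → Represents (j ∷ p) c _) (sym (lookup∘update′ (i≢j ∘ sym) cs c′))
                       (represents-unchanged (j ∷ p) (lookup cs j) (unchangedOutside-sibling same i≢j) (reps j))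

  -- An escaping walk is described by what it prepends to any walk continuing from the parent.
  Excursion : Vertex → List (Fin b) → Config → Config → Outcome → Set
  Excursion u p r r′ escaped      = ∀ {r″ v} → Walk r′ (nbr p zero) r″ v → Walk r u r″ v
  Excursion u p r r′ (absorbed s) = Walk r u r′ (node (s ++ p))

  nbr-suc : ∀ p i → nbr p (suc i) ≡ node (i ∷ p)
  nbr-suc []      i = refl
  nbr-suc (_ ∷ _) i = refl

  excursion-step : ∀ {p r r′} o → length p < h →
    Excursion (nbr p (next (r p))) p (update r p (next (r p))) r′ o → Excursion (node p) p r r′ o
  excursion-step escaped      p<h walk = step p<h ∘ walk
  excursion-step (absorbed s) p<h walk = step p<h walk

  excursion-via-child : ∀ {p r₁ r₂ r₃ i} o →
    Excursion (node (i ∷ p)) (i ∷ p) r₁ r₂ escaped → Excursion (node p) p r₂ r₃ o →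
    Excursion (node (i ∷ p)) p r₁ r₃ o
  excursion-via-child escaped      down up = down ∘ up
  excursion-via-child (absorbed s) down up = down up

  excursion-absorbed-in-child : ∀ {p r₁ r₂ i s} →
    Excursion (node (i ∷ p)) (i ∷ p) r₁ r₂ (absorbed s) → Excursion (node (i ∷ p)) p r₁ r₂ (absorbed (s ∷ʳ i))
  excursion-absorbed-in-child {p} {i = i} {s} =
    subst (λ q → Walk _ _ _ (node q)) (sym (++-assoc s (i ∷ []) p))

  above-leaves : ∀ {p : List (Fin b)} d → length p + suc d ≡ h → length p < h
  above-leaves {p} d |p|+1+d≡h = subst (length p <_) |p|+1+d≡h (m<m+n (length p) (s≤s z≤n))

  Realised : ∀ {d} → List (Fin b) → Config → Vertex → Outcome × RotorTree d → Set
  Realised p r u (o , t′) =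
    Σ Config λ r′ → Represents p t′ r′ × UnchangedOutside p r r′ × Excursion u p r r′ o

  mutual
    enter-realised : ∀ d p (t : RotorTree d) r → length p + d ≡ h → Represents p t r →
      Realised p r (node p) (enter d t)
    enter-realised zero    p leaf r |p|≡h _   =
      r , tt , (λ _ _ → refl) , atSink (trans (sym (+-identityʳ _)) |p|≡h)
    enter-realised (suc d) p t    r |p|≡h rep =
      enterWithin-realised d (suc b) p t r |p|≡h rep (parent-in-turn (rotor t))

    enterWithin-realised : ∀ d f p (t : RotorTree (suc d)) r → length p + suc d ≡ h → Represents p t r →
      0 < occurrences _≟F_ zero (orbit (rotor t) f) → Realised p r (node p) (enterWithin d f t)
    enterWithin-realised d (suc f) p (fork .(r p) cs) r |p|≡h (refl , reps) has-parent
      with move-realised d f p (next (r p)) cs (update r p (next (r p))) |p|≡h (update-here r p _)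
             (λ i → represents-unchanged (i ∷ p) (lookup cs i) (update-unchangedWithin-child r p _ i) (reps i))
             has-parent
    ... | r′ , rep′ , same , walk =
      r′ , rep′ , unchangedOutside-trans (update-unchangedOutside r p _) same ,
      excursion-step _ (above-leaves {p} d |p|≡h) walk

    move-realised : ∀ d f p x (cs : Vec (RotorTree d) b) r₁ → length p + suc d ≡ h → r₁ p ≡ x →
      (∀ i → Represents (i ∷ p) (lookup cs i) r₁) → 0 < occurrences _≟F_ zero (x ∷ orbit x f) →
      Realised p r₁ (nbr p x) (proceed d f (move d x cs))
    move-realised d f p zero cs r₁ |p|≡h r₁p≡x reps _ =
      r₁ , (r₁p≡x , reps) , (λ _ _ → refl) , λ walk → walk
    move-realised d f p (suc i) cs r₁ |p|≡h r₁p≡x reps has-parent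
      with enter d (lookup cs i)
         | enter-realised d (i ∷ p) (lookup cs i) r₁ (trans (sym (+-suc (length p) d)) |p|≡h) (reps i)
    ... | absorbed s , c′ | r₂ , rep₂ , same₂ , walk₂ =
      r₂ , represents-after-child cs c′ r₁p≡x reps rep₂ same₂ , unchangedOutside-parent i same₂ ,
      subst (λ u → Excursion u p r₁ r₂ (absorbed (s ∷ʳ i))) (sym (nbr-suc p i)) (excursion-absorbed-in-child walk₂)
    ... | escaped , c′ | r₂ , rep₂ , same₂ , walk₂
      with enterWithin-realised d f p (fork (suc i) (cs [ i ]≔ c′)) r₂ |p|≡h
             (represents-after-child cs c′ r₁p≡x reps rep₂ same₂) has-parent
    ...   | r₃ , rep₃ , same₃ , walk₃ =
      r₃ , rep₃ , unchangedOutside-trans (unchangedOutside-parent i same₂) same₃ ,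
      subst (λ u → Excursion u p r₁ r₃ _) (sym (nbr-suc p i)) (excursion-via-child _ walk₂ walk₃)

  fromConfig : ∀ d → List (Fin b) → Config → RotorTree d
  fromConfig zero    p r = leaf
  fromConfig (suc d) p r = fork (r p) (tabulate λ i → fromConfig d (i ∷ p) r)

  represents-fromConfig : ∀ d p r → Represents p (fromConfig d p r) r
  represents-fromConfig zero    p r = tt
  represents-fromConfig (suc d) p r = refl , λ i →
    subst (λ c → Represents (i ∷ p) c r) (sym (lookup∘tabulate _ i)) (represents-fromConfig d (i ∷ p) r)

  toVertex : Outcome → Vertex
  toVertex escaped      = root
  toVertex (absorbed s) = node s

  toVertex-injective : ∀ {o o′} → toVertex o ≡ toVertex o′ → o ≡ o′
  toVertex-injective {escaped}    {escaped}    _    = refl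
  toVertex-injective {absorbed s} {absorbed s} refl = refl

  toVertex-exit : ∀ {o} → Exit h o →
    toVertex o ≡ root ⊎ Σ (List (Fin b)) λ p → toVertex o ≡ node p × length p ≡ h
  toVertex-exit escaped           = inj₁ refl
  toVertex-exit (absorbed |s|≡h) = inj₂ (_ , refl , |s|≡h)

  particle : ∀ {r r′} o → Excursion (node []) [] r r′ o → Particle r r′ (toVertex o)
  particle escaped      walk = walk atRoot
  particle (absorbed s) walk = subst (λ q → Walk _ _ _ (node q)) (++-identityʳ s) walk

  particles : ∀ n (t : RotorTree h) r → Represents [] t r → Run n r (map toVertex (entries h n t))
  particles zero    t r _   = done
  particles (suc n) t r rep with enter-realised h [] t r refl rep
  ... | r′ , rep′ , _ , walk = more (particle _ walk) (particles n _ r′ rep′)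

proposition22 : (b h : ℕ) → 2 ≤ b → 1 ≤ h → (r : Tree.Config b h) →
    Σ (List (Tree.Vertex b h)) λ vs →
    Tree.Run b h (geomSum b h) r vs
    × ((p : List _) → length p ≡ h → Tree.count b h (Tree.node p) vs ≡ 1)
    × All (λ v → v ≡ Tree.root ⊎ Σ (List _) λ p → v ≡ Tree.node p × length p ≡ h) vs
proposition22 b h _ _ r =
  map toVertex outcomes ,
  particles (geomSum b h) tree r (represents-fromConfig h [] r) ,
  (λ p |p|≡h → trans (occurrences-map-injective _≟O_ _≟V_ toVertex toVertex-injective (absorbed p) outcomes)
                     (absorbed-once balanced p |p|≡h)) ,
  map⁺ (All.map toVertex-exit (all-exits balanced))
  where
  open Tree b h
  open Model b h
  open Realisation b h
  open OnePerLeaf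
  tree     = fromConfig h [] r
  outcomes = entries h (geomSum b h) tree
  balanced = entries-onePerLeaf h tree
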